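{- Let $n\ge2$, let $0\le\alpha_1<\dots<\alpha_n$ be integers, and let $1\le k<n$. For a sequence $X=(x_1,\dots,x_k)$ of positive integers, with $p_i=\sum_{j\le i}x_j$, $q_i=\sum_{j\le i}\alpha_jx_j$ ($p_0=q_0=0$), the following are equivalent: (i) for every $i\in\{1,\dots,k\}$, $q_{i-1}-p_{i-1}(p_{i-1}-1)/2\ge0$ and $1\le x_i\le \frac{h_i+\sqrt{h_i^2+8(q_{i-1}-p_{i-1}(p_{i-1}-1)/2)}}{2}$ where $h_i=2(\alpha_i-p_{i-1})+1$; (ii) $X$ appears in the net built by the first part of the net-building algorithm (described in the context) on input $D=\{\alpha_1,\dots,\alpha_n\}$ once the outer loop has completed its $k$-th iteration, i.e. for every $i\in\{1,\dots,k\}$ the triple $(p_{i-1},q_{i-1},x_i)$ belongs to the cell $L_i(p_i,q_i)$.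
   Context: Set $\alpha_0=0$. For each $k=0,\dots,n$ the algorithm maintains a table $L_k$ whose cells are indexed by pairs $(p,q)$ of integers with $0\le p\le 2\alpha_k+1$ and $0\le q\le (2\alpha_k+1)\alpha_k$; each cell is a set of triples $(p',q',x)$, initially empty except $L_0(0,0)=\{(0,0,0)\}$. Let $B(p',q',a)=\frac{h+\sqrt{h^2+8(q'-p'(p'-1)/2)}}{2}$ with $h=2(a-p')+1$. First part (outer loop): for $\ell=1,\dots,n-1$, for each integer $x$ with $1\le x\le 2\alpha_\ell+1$, for each $(p',q')$ with $0\le p'\le 2\alpha_{\ell-1}+1$, $0\le q'\le(2\alpha_{\ell-1}+1)\alpha_{\ell-1}$ and $L_{\ell-1}(p',q')\ne\emptyset$: if $x\le B(p',q',\alpha_\ell)$, insert $(p',q',x)$ into $L_\ell(p'+x,q'+x\alpha_\ell)$. -}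

module Defs where

open import Data.Nat using (ℕ; zero; suc; _+_; _*_; _∸_; _≤_; _<_; _<?_)
open import Data.Nat.DivMod using (_/_)
open import Data.Fin using (Fin; fromℕ<; toℕ)
open import Data.Integer as ℤ using (ℤ; +_; 0ℤ)
open import Data.Product using (_×_)
open import Data.Sum using (_⊎_)
open import Relation.Nullary using (yes; no)

-- 1-indexed view of a finite sequence f = (f_1,...,f_m) (given as Fin m → ℕ,
-- with f_i = f (i-1)); index 0 gives 0 (this realises α₀ = 0), indices > m give 0.
ext : {m : ℕ} → (Fin m → ℕ) → ℕ → ℕ
ext f zero = 0
ext {m} f (suc i) with i <? m
... | yes h = f (fromℕ< h)
... | no _  = 0

psum : (ℕ → ℕ) → ℕ → ℕ
psum xs zero    = 0
psum xs (suc i) = psum xs i + xs (suc i)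

qsum : (ℕ → ℕ) → (ℕ → ℕ) → ℕ → ℕ
qsum A xs zero    = 0
qsum A xs (suc i) = qsum A xs i + A (suc i) * xs (suc i)

-- q - p(p-1)/2, as an integer (p(p-1)/2 is an exact natural division)
Dsc : ℕ → ℕ → ℤ
Dsc p q = + q ℤ.- + ((p * (p ∸ 1)) / 2)

hh : ℕ → ℕ → ℤ
hh a p = + (2 * a + 1) ℤ.- + (2 * p)

-- For integers y and s ≥ 0:  y ≤ √s  (real square root) holds iff y ≤ 0 or y² ≤ s.
-- This is the literal meaning of the real inequality, stated without reals.
LeSqrt : ℤ → ℤ → Set
LeSqrt y s = (y ℤ.≤ 0ℤ) ⊎ (y ℤ.* y ℤ.≤ s)

-- x ≤ B(p,q,a) = (h + √(h² + 8(q - p(p-1)/2)))/2, h = 2(a-p)+1,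
-- i.e.  2x - h ≤ √(h² + 8 D). Includes D ≥ 0 (the square root must be defined).
LeB : ℕ → ℕ → ℕ → ℕ → Set
LeB a p q x = (0ℤ ℤ.≤ Dsc p q)
            × LeSqrt (+ (2 * x) ℤ.- hh a p) (hh a p ℤ.* hh a p ℤ.+ + 8 ℤ.* Dsc p q)

-- InL A ℓ p q p' q' x  :  the triple (p',q',x) belongs to the cell L_ℓ(p,q)
-- of the table produced by the first part of the net-building algorithm,
-- where A ℓ = α_ℓ (A 0 = 0). The cell (p,q) of L_ℓ exists only when
-- p ≤ 2α_ℓ+1 and q ≤ (2α_ℓ+1)α_ℓ.
data InL (A : ℕ → ℕ) : ℕ → ℕ → ℕ → ℕ → ℕ → ℕ → Set where
  base : InL A 0 0 0 0 0 0
  step : ∀ {ℓ p' q' p'' q'' y x} →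
         p' ≤ 2 * A ℓ + 1 →
         q' ≤ (2 * A ℓ + 1) * A ℓ →
         InL A ℓ p' q' p'' q'' y →
         -- loop range for x
         1 ≤ x → x ≤ 2 * A (suc ℓ) + 1 →
         LeB (A (suc ℓ)) p' q' x →
         p' + x ≤ 2 * A (suc ℓ) + 1 →
         q' + x * A (suc ℓ) ≤ (2 * A (suc ℓ) + 1) * A (suc ℓ) →
         InL A (suc ℓ) (p' + x) (q' + x * A (suc ℓ)) p' q' x

CondI : (n : ℕ) → (Fin n → ℕ) → (k : ℕ) → (Fin k → ℕ) → Set
CondI n α k x = (i : Fin k) →
  let A = ext α ; xs = ext x ; j = toℕ i
      p = psum xs j ; q = qsum A xs j
  in (0ℤ ℤ.≤ Dsc p q) × (1 ≤ x i) × LeB (A (suc j)) p q (x i)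

CondII : (n : ℕ) → (Fin n → ℕ) → (k : ℕ) → (Fin k → ℕ) → Set
CondII n α k x = (i : Fin k) →
  let A = ext α ; xs = ext x ; j = toℕ i
  in InL A (suc j) (psum xs (suc j)) (qsum A xs (suc j))
                   (psum xs j) (qsum A xs j) (x i)

-- Write T(p) = p(p-1)/2 and D(p,q) = q - T(p).  Since 2·D(p+x, q+ax) = 2·D(p,q) + hx - x² with
-- h = 2(a-p)+1, the test x ≤ B(p,q,a) (x below the larger root of X² - hX - 2D) says exactly that
-- D stays nonnegative after appending x.  As α is increasing, q_i ≤ α_i p_i, and together with
-- T(p_i) ≤ q_i this gives p_i ≤ 2α_i+1 and q_i ≤ (2α_i+1)α_i: every cell the algorithm visits
-- exists.  Hence the entries of (i) are inserted level by level, and conversely every entry of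
-- L_i passed the test when it was inserted.
module Submission where

open import Defs
open import Data.Nat using (ℕ; _≤_; _<_; zero; suc; _+_; _*_; _∸_; z≤n; _<?_)
open import Data.Fin as Fin using (Fin; fromℕ<; toℕ)
open import Function.Bundles using (_⇔_; mk⇔; Equivalence)

open import Data.Nat.Properties
  using (*-comm; *-identityʳ; *-distribˡ-+; *-distribˡ-∸; m+n∸n≡m; ≤-trans; ≤-reflexive; <⇒≤; n<1+n;
         <-trans; m≤n+m; +-monoˡ-≤; *-monoˡ-≤; *-monoʳ-≤; *-cancelʳ-≤; module ≤-Reasoning)
open import Data.Nat.DivMod using (_/_; m*n/n≡m)
open import Data.Nat.Tactic.RingSolver as ℕ-Solver using ()
open import Data.Integer as ℤ using (+_; 0ℤ; +≤+)
open import Data.Integer.Properties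
  using (pos-+; pos-*; drop‿+≤+; neg-mono-≤; +-mono-≤; i≤j⇒0≤j-i; 0≤i-j⇒j≤i; *-cancelʳ-≤-pos; *-cancelˡ-≤-pos)
open import Data.Integer.Tactic.RingSolver as ℤ-Solver using ()
open import Data.Fin.Properties using (toℕ-fromℕ<; fromℕ<-toℕ; toℕ<n)
open import Data.Product using (_×_; _,_)
open import Data.Sum using (inj₁; inj₂)
open import Data.Empty using (⊥-elim)
open import Relation.Nullary using (yes; no)
open import Relation.Binary.PropositionalEquality

triangle : ℕ → ℕ
triangle zero    = 0
triangle (suc n) = triangle n + n

2*triangle+n≡n*n : ∀ n → 2 * triangle n + n ≡ n * n
2*triangle+n≡n*n zero    = refl
2*triangle+n≡n*n (suc n) = begin
  2 * (triangle n + n) + suc n     ≡⟨ regroup (triangle n) n ⟩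
  (2 * triangle n + n) + (2 * n + 1) ≡⟨ cong (_+ (2 * n + 1)) (2*triangle+n≡n*n n) ⟩
  n * n + (2 * n + 1)              ≡⟨ square-suc n ⟩
  suc n * suc n                    ∎
  where
  open ≡-Reasoning
  regroup : ∀ t n → 2 * (t + n) + suc n ≡ (2 * t + n) + (2 * n + 1)
  regroup = ℕ-Solver.solve-∀
  square-suc : ∀ n → n * n + (2 * n + 1) ≡ suc n * suc n
  square-suc = ℕ-Solver.solve-∀

n*[n∸1]/2≡triangle : ∀ n → n * (n ∸ 1) / 2 ≡ triangle n
n*[n∸1]/2≡triangle n = begin
  n * (n ∸ 1) / 2                  ≡⟨ cong (_/ 2) n*[n∸1]≡triangle*2 ⟩
  triangle n * 2 / 2               ≡⟨ m*n/n≡m (triangle n) 2 ⟩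
  triangle n                       ∎
  where
  open ≡-Reasoning
  n*[n∸1]≡triangle*2 : n * (n ∸ 1) ≡ triangle n * 2
  n*[n∸1]≡triangle*2 = begin
    n * (n ∸ 1)                    ≡⟨ *-distribˡ-∸ n n 1 ⟩
    n * n ∸ n * 1                  ≡⟨ cong₂ _∸_ (sym (2*triangle+n≡n*n n)) (*-identityʳ n) ⟩
    2 * triangle n + n ∸ n         ≡⟨ m+n∸n≡m (2 * triangle n) n ⟩
    2 * triangle n                 ≡⟨ *-comm 2 (triangle n) ⟩
    triangle n * 2                 ∎

Dsc≡q-triangle : ∀ p q → Dsc p q ≡ + q ℤ.- + triangle p
Dsc≡q-triangle p q = cong (λ t → + q ℤ.- + t) (n*[n∸1]/2≡triangle p)

0≤Dsc⇒triangle≤ : ∀ p {q} → 0ℤ ℤ.≤ Dsc p q → triangle p ≤ q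
0≤Dsc⇒triangle≤ p {q} 0≤D = drop‿+≤+ (0≤i-j⇒j≤i (subst (0ℤ ℤ.≤_) (Dsc≡q-triangle p q) 0≤D))

Dsc*2≡2q+p-p*p : ∀ p q → Dsc p q ℤ.* + 2 ≡ + q ℤ.* + 2 ℤ.+ + p ℤ.- + p ℤ.* + p
Dsc*2≡2q+p-p*p p q = begin
  Dsc p q ℤ.* + 2                                    ≡⟨ cong (ℤ._* + 2) (Dsc≡q-triangle p q) ⟩
  (+ q ℤ.- + t) ℤ.* + 2                              ≡⟨ expand (+ q) (+ t) (+ p) ⟩
  + q ℤ.* + 2 ℤ.+ + p ℤ.- (+ 2 ℤ.* + t ℤ.+ + p)      ≡⟨ cong (ℤ._-_ (+ q ℤ.* + 2 ℤ.+ + p)) 2*triangle+p≡p*p ⟩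
  + q ℤ.* + 2 ℤ.+ + p ℤ.- + p ℤ.* + p                ∎
  where
  open ≡-Reasoning
  t = triangle p
  expand : ∀ q t p → (q ℤ.- t) ℤ.* + 2 ≡ q ℤ.* + 2 ℤ.+ p ℤ.- (+ 2 ℤ.* t ℤ.+ p)
  expand = ℤ-Solver.solve-∀
  2*triangle+p≡p*p : + 2 ℤ.* + t ℤ.+ + p ≡ + p ℤ.* + p
  2*triangle+p≡p*p = begin
    + 2 ℤ.* + t ℤ.+ + p                              ≡⟨ cong (ℤ._+ + p) (sym (pos-* 2 t)) ⟩
    + (2 * t) ℤ.+ + p                                ≡⟨ sym (pos-+ (2 * t) p) ⟩
    + (2 * t + p)                                    ≡⟨ cong +_ (2*triangle+n≡n*n p) ⟩
    + (p * p)                                        ≡⟨ pos-* p p ⟩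
    + p ℤ.* + p                                      ∎

hh≡ : ∀ a p → hh a p ≡ + 2 ℤ.* + a ℤ.+ + 1 ℤ.- + 2 ℤ.* + p
hh≡ a p = cong₂ ℤ._-_ (trans (pos-+ (2 * a) 1) (cong (ℤ._+ + 1) (pos-* 2 a))) (pos-* 2 p)

Dsc-step : ∀ a p q x → Dsc (p + x) (q + x * a) ℤ.* + 2 ≡ Dsc p q ℤ.* + 2 ℤ.+ + x ℤ.* hh a p ℤ.- + x ℤ.* + x
Dsc-step a p q x = begin
  Dsc (p + x) (q + x * a) ℤ.* + 2
    ≡⟨ Dsc*2≡2q+p-p*p (p + x) (q + x * a) ⟩
  + (q + x * a) ℤ.* + 2 ℤ.+ + (p + x) ℤ.- + (p + x) ℤ.* + (p + x)
    ≡⟨ cong₂ (λ Q P → Q ℤ.* + 2 ℤ.+ P ℤ.- P ℤ.* P)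
             (trans (pos-+ q (x * a)) (cong (λ r → + q ℤ.+ r) (pos-* x a))) (pos-+ p x) ⟩
  (+ q ℤ.+ + x ℤ.* + a) ℤ.* + 2 ℤ.+ (+ p ℤ.+ + x) ℤ.- (+ p ℤ.+ + x) ℤ.* (+ p ℤ.+ + x)
    ≡⟨ regroup (+ q) (+ p) (+ x) (+ a) ⟩
  (+ q ℤ.* + 2 ℤ.+ + p ℤ.- + p ℤ.* + p) ℤ.+ + x ℤ.* (+ 2 ℤ.* + a ℤ.+ + 1 ℤ.- + 2 ℤ.* + p) ℤ.- + x ℤ.* + x
    ≡⟨ cong₂ (λ D h → D ℤ.+ + x ℤ.* h ℤ.- + x ℤ.* + x) (sym (Dsc*2≡2q+p-p*p p q)) (sym (hh≡ a p)) ⟩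
  Dsc p q ℤ.* + 2 ℤ.+ + x ℤ.* hh a p ℤ.- + x ℤ.* + x
    ∎
  where
  open ≡-Reasoning
  regroup : ∀ q p x a →
    (q ℤ.+ x ℤ.* a) ℤ.* + 2 ℤ.+ (p ℤ.+ x) ℤ.- (p ℤ.+ x) ℤ.* (p ℤ.+ x)
      ≡ (q ℤ.* + 2 ℤ.+ p ℤ.- p ℤ.* p) ℤ.+ x ℤ.* (+ 2 ℤ.* a ℤ.+ + 1 ℤ.- + 2 ℤ.* p) ℤ.- x ℤ.* x
  regroup = ℤ-Solver.solve-∀

0≤i⇒0≤j⇒0≤i*j : ∀ {i j} → 0ℤ ℤ.≤ i → 0ℤ ℤ.≤ j → 0ℤ ℤ.≤ i ℤ.* j
0≤i⇒0≤j⇒0≤i*j {+ m} {+ n} _ _ = subst (0ℤ ℤ.≤_) (pos-* m n) (+≤+ z≤n)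

below-root⇒0≤2d+xh-x² : ∀ {d x h} → 0ℤ ℤ.≤ d → 0ℤ ℤ.≤ x →
  LeSqrt (+ 2 ℤ.* x ℤ.- h) (h ℤ.* h ℤ.+ + 8 ℤ.* d) → 0ℤ ℤ.≤ d ℤ.* + 2 ℤ.+ x ℤ.* h ℤ.- x ℤ.* x
below-root⇒0≤2d+xh-x² {d} {x} {h} 0≤d 0≤x (inj₁ 2x-h≤0) =
  subst (0ℤ ℤ.≤_) (sym (split d x h))
    (+-mono-≤ (+-mono-≤ (0≤i⇒0≤j⇒0≤i*j 0≤d (+≤+ z≤n)) (0≤i⇒0≤j⇒0≤i*j 0≤x (neg-mono-≤ 2x-h≤0)))
              (0≤i⇒0≤j⇒0≤i*j 0≤x 0≤x))
  where
  split : ∀ d x h → d ℤ.* + 2 ℤ.+ x ℤ.* h ℤ.- x ℤ.* x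
                  ≡ d ℤ.* + 2 ℤ.+ x ℤ.* ℤ.- (+ 2 ℤ.* x ℤ.- h) ℤ.+ x ℤ.* x
  split = ℤ-Solver.solve-∀
below-root⇒0≤2d+xh-x² {d} {x} {h} _ _ (inj₂ [2x-h]²≤disc) =
  *-cancelˡ-≤-pos 0ℤ _ (+ 4) (subst (0ℤ ℤ.≤_) (difference d x h) (i≤j⇒0≤j-i [2x-h]²≤disc))
  where
  difference : ∀ d x h → (h ℤ.* h ℤ.+ + 8 ℤ.* d) ℤ.- (+ 2 ℤ.* x ℤ.- h) ℤ.* (+ 2 ℤ.* x ℤ.- h)
                       ≡ + 4 ℤ.* (d ℤ.* + 2 ℤ.+ x ℤ.* h ℤ.- x ℤ.* x)
  difference = ℤ-Solver.solve-∀

LeB⇒triangle≤ : ∀ a p q x → LeB a p q x → triangle (p + x) ≤ q + x * a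
LeB⇒triangle≤ a p q x (0≤D , x≤B) = 0≤Dsc⇒triangle≤ (p + x) (*-cancelʳ-≤-pos 0ℤ _ (+ 2) 0≤D′*2)
  where
  0≤D′*2 : 0ℤ ℤ.≤ Dsc (p + x) (q + x * a) ℤ.* + 2
  0≤D′*2 = subst (0ℤ ℤ.≤_) (sym (Dsc-step a p q x))
    (below-root⇒0≤2d+xh-x² {Dsc p q} {+ x} {hh a p} 0≤D (+≤+ z≤n)
      (subst (λ y → LeSqrt (y ℤ.- hh a p) _) (pos-* 2 x) x≤B))

triangle≤a*p⇒p≤2a+1 : ∀ a {p} → triangle p ≤ a * p → p ≤ 2 * a + 1
triangle≤a*p⇒p≤2a+1 a {zero}  _ = z≤n
triangle≤a*p⇒p≤2a+1 a {p@(suc _)} t≤ap = *-cancelʳ-≤ p (2 * a + 1) p (begin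
  p * p                  ≡⟨ sym (2*triangle+n≡n*n p) ⟩
  2 * triangle p + p     ≤⟨ +-monoˡ-≤ p (*-monoʳ-≤ 2 t≤ap) ⟩
  2 * (a * p) + p        ≡⟨ factor a p ⟩
  (2 * a + 1) * p        ∎)
  where
  open ≤-Reasoning
  factor : ∀ a p → 2 * (a * p) + p ≡ (2 * a + 1) * p
  factor = ℕ-Solver.solve-∀

IsCell : ℕ → ℕ → ℕ → Set
IsCell a p q = p ≤ 2 * a + 1 × q ≤ (2 * a + 1) * a

isCell : ∀ a {p q} → triangle p ≤ q → q ≤ a * p → IsCell a p q
isCell a {p} {q} t≤q q≤ap =
  p≤2a+1 , ≤-trans q≤ap (≤-trans (*-monoʳ-≤ a p≤2a+1) (≤-reflexive (*-comm a (2 * a + 1))))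
  where
  p≤2a+1 : p ≤ 2 * a + 1
  p≤2a+1 = triangle≤a*p⇒p≤2a+1 a (≤-trans t≤q q≤ap)

Admissible : ℕ → ℕ → ℕ → ℕ → Set
Admissible a p q x = (0ℤ ℤ.≤ Dsc p q) × (1 ≤ x) × LeB a p q x

InL-admissible : ∀ {A ℓ p q p′ q′ x} → InL A (suc ℓ) p q p′ q′ x → Admissible (A (suc ℓ)) p′ q′ x
InL-admissible (step _ _ _ 1≤x _ x≤B@(0≤D , _) _ _) = 0≤D , 1≤x , x≤B

InL-extend : ∀ {A ℓ p q p′ q′ y x} → A ℓ ≤ A (suc ℓ) → q ≤ A ℓ * p → Admissible (A (suc ℓ)) p q x →
             InL A ℓ p q p′ q′ y → InL A (suc ℓ) (p + x) (q + A (suc ℓ) * x) p q x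
InL-extend {A} {ℓ} {p} {q} {x = x} Aℓ≤a q≤Aℓp (0≤D , 1≤x , x≤B) prev =
  subst (λ r → InL A (suc ℓ) (p + x) (q + r) p q x) (*-comm x a)
    (step-between (isCell (A ℓ) (0≤Dsc⇒triangle≤ p 0≤D) q≤Aℓp)
                  (isCell a (LeB⇒triangle≤ a p q x x≤B) q+xa≤a[p+x]))
  where
  open ≤-Reasoning
  a = A (suc ℓ)
  q+xa≤a[p+x] : q + x * a ≤ a * (p + x)
  q+xa≤a[p+x] = begin
    q + x * a      ≤⟨ +-monoˡ-≤ (x * a) (≤-trans q≤Aℓp (*-monoˡ-≤ p Aℓ≤a)) ⟩
    a * p + x * a  ≡⟨ cong (_+_ (a * p)) (*-comm x a) ⟩
    a * p + a * x  ≡⟨ sym (*-distribˡ-+ a p x) ⟩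
    a * (p + x)    ∎
  step-between : IsCell (A ℓ) p q → IsCell a (p + x) (q + x * a) → InL A (suc ℓ) (p + x) (q + x * a) p q x
  step-between (p≤ , q≤) (p+x≤ , q+xa≤) = step p≤ q≤ prev 1≤x (≤-trans (m≤n+m x p) p+x≤) x≤B p+x≤ q+xa≤

ext-suc : ∀ {m} (f : Fin m → ℕ) {j} (j<m : j < m) → ext f (suc j) ≡ f (fromℕ< j<m)
ext-suc {m} f {j} j<m with j <? m
... | yes _   = refl
... | no j≮m = ⊥-elim (j≮m j<m)

ext-mono : ∀ {m} {f : Fin m → ℕ} → (∀ i j → i Fin.< j → f i < f j) → ∀ j → j < m → ext f j ≤ ext f (suc j)
ext-mono f-inc zero    _     = z≤n
ext-mono {f = f} f-inc (suc j) 1+j<m = <⇒≤ (begin-strict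
  ext f (suc j)         ≡⟨ ext-suc f j<m ⟩
  f (fromℕ< j<m)        <⟨ f-inc _ _ (subst₂ _<_ (sym (toℕ-fromℕ< j<m)) (sym (toℕ-fromℕ< 1+j<m)) (n<1+n j)) ⟩
  f (fromℕ< 1+j<m)      ≡⟨ sym (ext-suc f 1+j<m) ⟩
  ext f (suc (suc j))   ∎)
  where
  open ≤-Reasoning
  j<m = <-trans (n<1+n j) 1+j<m

∀-Fin⇔∀-<-ext : ∀ {m} (f : Fin m → ℕ) (P : ℕ → ℕ → Set) →
                (∀ i → P (toℕ i) (f i)) ⇔ (∀ j → j < m → P j (ext f (suc j)))
∀-Fin⇔∀-<-ext f P = mk⇔
  (λ ∀i j j<m → subst₂ P (toℕ-fromℕ< j<m) (sym (ext-suc f j<m)) (∀i (fromℕ< j<m)))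
  (λ ∀j i → subst (P (toℕ i)) (ext-suc-toℕ i) (∀j (toℕ i) (toℕ<n i)))
  where
  ext-suc-toℕ : ∀ i → ext f (suc (toℕ i)) ≡ f i
  ext-suc-toℕ i = trans (ext-suc f (toℕ<n i)) (cong f (fromℕ<-toℕ i (toℕ<n i)))

-- Entry j of conditions (i) and (ii), counted from 0, with y standing for x_{j+1}.
Admissible-at InNet : (A xs : ℕ → ℕ) → ℕ → ℕ → Set
Admissible-at A xs j y = Admissible (A (suc j)) (psum xs j) (qsum A xs j) y
InNet A xs j y = InL A (suc j) (psum xs (suc j)) (qsum A xs (suc j)) (psum xs j) (qsum A xs j) y

module _ {A xs : ℕ → ℕ} {k : ℕ} (A-mono : ∀ j → j < k → A j ≤ A (suc j)) where

  qsum≤A*psum : ∀ j → j ≤ k → qsum A xs j ≤ A j * psum xs j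
  qsum≤A*psum zero    _   = z≤n
  qsum≤A*psum (suc j) j<k = begin
    qsum A xs j + a * xs (suc j)      ≤⟨ +-monoˡ-≤ (a * xs (suc j)) q≤A[j+1]*p ⟩
    a * psum xs j + a * xs (suc j)    ≡⟨ sym (*-distribˡ-+ a (psum xs j) (xs (suc j))) ⟩
    a * psum xs (suc j)               ∎
    where
    open ≤-Reasoning
    a = A (suc j)
    q≤A[j+1]*p : qsum A xs j ≤ a * psum xs j
    q≤A[j+1]*p = ≤-trans (qsum≤A*psum j (<⇒≤ j<k)) (*-monoˡ-≤ (psum xs j) (A-mono j j<k))

  admissible⇒inNet : (∀ j → j < k → Admissible-at A xs j (xs (suc j))) → ∀ j → j < k → InNet A xs j (xs (suc j))
  admissible⇒inNet admissible = reached
    where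
    extend : ∀ {j p′ q′ y} → j < k → InL A j (psum xs j) (qsum A xs j) p′ q′ y → InNet A xs j (xs (suc j))
    extend {j} j<k = InL-extend (A-mono j j<k) (qsum≤A*psum j (<⇒≤ j<k)) (admissible j j<k)

    reached : ∀ j → j < k → InNet A xs j (xs (suc j))
    reached zero    0<k   = extend 0<k base
    reached (suc j) 1+j<k = extend 1+j<k (reached j (<-trans (n<1+n j) 1+j<k))

lemma3p3 : (n : ℕ) → 2 ≤ n →
           (α : Fin n → ℕ) → (∀ (i j : Fin n) → i Fin.< j → α i < α j) →
           (k : ℕ) → 1 ≤ k → k < n →
           (x : Fin k → ℕ) → (∀ (i : Fin k) → 1 ≤ x i) →
           CondI n α k x ⇔ CondII n α k x
lemma3p3 n _ α α-increasing k _ k<n x _ = mk⇔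
  (λ condI → Equivalence.from (∀-Fin⇔∀-<-ext x (InNet A xs))
               (admissible⇒inNet A-mono (Equivalence.to (∀-Fin⇔∀-<-ext x (Admissible-at A xs)) condI)))
  (λ condII i → InL-admissible (condII i))
  where
  A = ext α
  xs = ext x
  A-mono : ∀ j → j < k → A j ≤ A (suc j)
  A-mono j j<k = ext-mono α-increasing j (<-trans j<k k<n)
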